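{- Let $H$ be a locally finite Borel $3$-uniform hypergraph with vertex set $V\subseteq\mathbb{N}^{\mathbb{N}}$ and hyperedge set $E\subseteq V^3$, let $\preceq$ be a Borel linear order on $\mathbb{N}^{\mathbb{N}}$, $E_{\mathrm{sort}}=\{(v_1,v_2,v_3)\in E: v_1\preceq v_2\preceq v_3\}$, and let $D(H)$ be the directed graph with vertex set $V\cup(E_{\mathrm{sort}}\times\{a',b',c'\})$ whose arcs are, for each $e=(v_1,v_2,v_3)\in E_{\mathrm{sort}}$, the images of the template arcs $a\to b,\ b\to c,\ a\to c,\ a'\to b',\ b'\to c',\ c'\to a',\ c'\to a,\ c\to a',\ b'\to a,\ b\to c',\ a'\to b,\ c\to b'$ under $a\mapsto v_1$, $b\mapsto v_2$, $c\mapsto v_3$, $t\mapsto(e,t)$ for $t\in\{a',b',c'\}$. If $H$ admits a Borel $2$-coloring, then $D(H)$ admits a Borel $2$-dicoloring.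
   Context: A Borel $2$-coloring of a $3$-uniform hypergraph is a Borel map $V\to\{0,1\}$ that is not constant on any hyperedge. A Borel $2$-dicoloring of a directed graph is a Borel map from its vertex set to $\{0,1\}$ such that each color class induces no directed cycle. The hypergraph is locally finite if every vertex lies in finitely many hyperedges. The labels $a',b',c'$ are three fixed distinct points. -}

module Defs where

open import Data.Nat using (ℕ; zero; suc)
open import Data.Bool using (Bool; true; false)
open import Data.Fin using (Fin; zero; suc; fromℕ; inject₁)
open import Data.List using (List; []; _∷_)
open import Data.List.Membership.Propositional using (_∈_)
open import Data.Product using (Σ; ∃; ∃-syntax; _×_; _,_; proj₁; proj₂)
open import Data.Sum using (_⊎_; inj₁; inj₂)
open import Data.Unit using (⊤)
open import Data.Empty using (⊥)
open import Relation.Nullary using (¬_)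
open import Relation.Binary.PropositionalEquality using (_≡_)
open import Function using (_∘_; _⇔_)

Baire : Set
Baire = ℕ → ℕ

_≈_ : Baire → Baire → Set
x ≈ y = ∀ n → x n ≡ y n

Extends : Baire → List ℕ → Set
Extends x []      = ⊤
Extends x (a ∷ s) = (x 0 ≡ a) × Extends (x ∘ suc) s

data Borel : Set where
  cyl   : List ℕ → Borel
  compl : Borel → Borel
  ⋃     : (ℕ → Borel) → Borel

_∈B_ : Baire → Borel → Set
x ∈B cyl s   = Extends x s
x ∈B compl B = ¬ (x ∈B B)
x ∈B ⋃ Bs    = Σ ℕ λ n → x ∈B Bs n

-- the standard homeomorphism (ℕ^ℕ)^2 ≅ ℕ^ℕ (interleaving), used to
-- speak of Borel subsets of (ℕ^ℕ)^2 and (ℕ^ℕ)^3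
pair : Baire → Baire → Baire
pair x y zero          = x 0
pair x y (suc zero)    = y 0
pair x y (suc (suc n)) = pair (x ∘ suc) (y ∘ suc) n

triple : Baire → Baire → Baire → Baire
triple x y z = pair x (pair y z)

record Borel3Hypergraph : Set₁ where
  field
    V : Borel
    E : Borel
    E⊆V³ : ∀ {x y z} → triple x y z ∈B E → (x ∈B V) × (y ∈B V) × (z ∈B V)
    -- hyperedges are 3-element sets: distinct vertices, and the set of
    -- ordered triples representing them is closed under permutations
    distinct : ∀ {x y z} → triple x y z ∈B E →
               ¬ (x ≈ y) × ¬ (y ≈ z) × ¬ (x ≈ z)
    sym₁₂ : ∀ {x y z} → triple x y z ∈B E → triple y x z ∈B E
    sym₂₃ : ∀ {x y z} → triple x y z ∈B E → triple x z y ∈B E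

module _ (H : Borel3Hypergraph) where
  open Borel3Hypergraph H

  VPt : Set
  VPt = Σ Baire (_∈B V)

  LocallyFinite : Set
  LocallyFinite =
    ∀ (v : VPt) → Σ (List Baire) λ L → ∀ x y z → triple x y z ∈B E →
      (x ≈ proj₁ v ⊎ y ≈ proj₁ v ⊎ z ≈ proj₁ v) →
      ∃[ t ] (t ∈ L × (∀ n → triple x y z n ≡ t n))

  IsBorelMapV : (VPt → Bool) → Set
  IsBorelMapV f = ∃[ B ] ∀ x (p : x ∈B V) → (f (x , p) ≡ true ⇔ x ∈B B)

  Borel2Coloring : Set
  Borel2Coloring =
    Σ (VPt → Bool) λ f → IsBorelMapV f ×
      (∀ x y z (px : x ∈B V) (py : y ∈B V) (pz : z ∈B V) →
         triple x y z ∈B E →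
         ¬ ((f (x , px) ≡ f (y , py)) × (f (y , py) ≡ f (z , pz))))

record BorelLinearOrder : Set where
  field
    L : Borel
  _⪯_ : Baire → Baire → Set
  x ⪯ y = pair x y ∈B L
  field
    refl⪯    : ∀ x → x ⪯ x
    antisym⪯ : ∀ {x y} → x ⪯ y → y ⪯ x → x ≈ y
    trans⪯   : ∀ {x y z} → x ⪯ y → y ⪯ z → x ⪯ z
    total⪯   : ∀ x y → (x ⪯ y) ⊎ (y ⪯ x)

data Tmpl : Set where
  a b c a' b' c' : Tmpl

data TArc : Tmpl → Tmpl → Set where
  a→b   : TArc a b
  b→c   : TArc b c
  a→c   : TArc a c
  a'→b' : TArc a' b'
  b'→c' : TArc b' c'
  c'→a' : TArc c' a'
  c'→a  : TArc c' a
  c→a'  : TArc c a'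
  b'→a  : TArc b' a
  b→c'  : TArc b c'
  a'→b  : TArc a' b
  c→b'  : TArc c b'

data Label : Set where
  a'ℓ b'ℓ c'ℓ : Label

module DGraph (H : Borel3Hypergraph) (O : BorelLinearOrder) where
  open Borel3Hypergraph H
  open BorelLinearOrder O

  ESortPt : Set
  ESortPt = Σ (Baire × Baire × Baire) λ { (x , y , z) →
              (triple x y z ∈B E) × (x ⪯ y) × (y ⪯ z) }

  DV : Set
  DV = VPt H ⊎ (ESortPt × Label)

  _≋_ : DV → DV → Set
  inj₁ (x , _) ≋ inj₁ (y , _) = x ≈ y
  inj₁ _ ≋ inj₂ _ = ⊥
  inj₂ _ ≋ inj₁ _ = ⊥
  inj₂ (((x , y , z) , _) , s) ≋ inj₂ (((x' , y' , z') , _) , t) =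
    (x ≈ x') × (y ≈ y') × (z ≈ z') × (s ≡ t)

  img : ESortPt → Tmpl → DV
  img e@((x , y , z) , p , _) a  = inj₁ (x , proj₁ (E⊆V³ p))
  img e@((x , y , z) , p , _) b  = inj₁ (y , proj₁ (proj₂ (E⊆V³ p)))
  img e@((x , y , z) , p , _) c  = inj₁ (z , proj₂ (proj₂ (E⊆V³ p)))
  img e a' = inj₂ (e , a'ℓ)
  img e b' = inj₂ (e , b'ℓ)
  img e c' = inj₂ (e , c'ℓ)

  Arc : DV → DV → Set
  Arc u w = Σ ESortPt λ e → Σ Tmpl λ s → Σ Tmpl λ t →
              TArc s t × (u ≋ img e s) × (w ≋ img e t)

  IsBorelMapD : (DV → Bool) → Set
  IsBorelMapD g =
    (∃[ B ] ∀ x (p : x ∈B V) → (g (inj₁ (x , p)) ≡ true ⇔ x ∈B B)) ×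
    (∀ (ℓ : Label) → ∃[ B ] ∀ (e : ESortPt) →
       (g (inj₂ (e , ℓ)) ≡ true ⇔
        (let ((x , y , z) , _) = e in triple x y z ∈B B)))

  -- a closed directed walk w 0 → w 1 → ⋯ → w k → w 0 of length k+1
  ClosedWalk : (k : ℕ) → (Fin (suc k) → DV) → Set
  ClosedWalk k w = (∀ (i : Fin k) → Arc (w (inject₁ i)) (w (suc i)))
                 × Arc (w (fromℕ k)) (w zero)

  -- Borel 2-dicoloring: no color class contains a directed cycle
  -- (equivalently, no monochromatic closed directed walk)
  Borel2Dicoloring : Set
  Borel2Dicoloring =
    Σ (DV → Bool) λ g → IsBorelMapD g ×
      (∀ k (w : Fin (suc k) → DV) → ClosedWalk k w →
         ¬ (∀ i → g (w i) ≡ g (w zero)))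

module Submission where

open import Defs
open import Data.Bool using (Bool; true; false; not; _∧_; _∨_; _xor_; if_then_else_)
import Data.Bool.Properties as Bool
open import Data.Empty using (⊥-elim)
open import Data.Fin using (Fin; #_; inject₁; fromℕ)
import Data.Fin as Fin
import Data.Fin.Properties as Fin
open import Data.List using (List; []; _∷_)
open import Data.Nat using (ℕ; zero; suc)
import Data.Nat as ℕ
import Data.Nat.Properties as ℕ
open import Data.Product using (Σ; _×_; _,_; proj₁; proj₂)
open import Data.Product.Relation.Binary.Lex.Strict
  using (×-Lex; ×-transitive; ×-irreflexive; ×-respects₂; ×-decidable)
open import Data.Product.Relation.Binary.Pointwise.NonDependent using () renaming (Pointwise to Pointwise₂)
open import Data.Sum using (inj₁; inj₂)
open import Data.Unit using (tt)
open import Data.Vec using (Vec; []; _∷_)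
open import Data.Vec.Relation.Binary.Pointwise.Inductive using (Pointwise; []; _∷_)
open import Function using (_∘_; _⇔_; Equivalence; mk⇔)
open import Function.Properties.Equivalence using () renaming (refl to ⇔-refl; sym to ⇔-sym; trans to ⇔-trans)
open import Relation.Binary.Bundles using (Setoid)
open import Relation.Binary.Definitions using (Transitive; Irreflexive; _Respects₂_)
open import Relation.Binary.PropositionalEquality
  using (_≡_; refl; sym; trans; cong₂; subst; resp₂; _→-setoid_; module ≡-Reasoning)
open import Relation.Binary.Structures using (IsEquivalence)
open import Relation.Nullary using (¬_)
open import Relation.Nullary.Decidable using (Dec; map′; ¬?; _×-dec_; _→-dec_; True; toWitness)
open import Relation.Nullary.Reflects using (Reflects; ofʸ; ofⁿ; ¬-reflects; _⊎-reflects_; det)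

open Equivalence using (to; from)

-- Colour each vertex of D(H) as in H, and the three labelled vertices of a sorted hyperedge
-- (v₁, v₂, v₃) by Boolean functions of the colours of v₁, v₂, v₃; these are Borel because the
-- coordinate projections (ℕ^ℕ)³ → ℕ^ℕ are Borel. For acyclicity, every vertex gets a key in
-- ℕ^ℕ × ℕ, ordered lexicographically by ⪯ and then <: a vertex v of H has key (v, 2), and the
-- labelled vertices of a hyperedge sit at v₁ (levels 0, 1, 4) when v₁ and v₂ have the same
-- colour and at v₃ (levels 3, 3, 4) otherwise. A check of the 12 template arcs against the 6
-- non-constant colourings of (v₁, v₂, v₃) shows that every monochromatic arc strictly
-- increases the key, so no closed walk is monochromatic.

≈-isEquivalence : IsEquivalence _≈_
≈-isEquivalence = Setoid.isEquivalence (ℕ →-setoid ℕ)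

open IsEquivalence ≈-isEquivalence using () renaming (refl to ≈-refl; sym to ≈-sym)

∈B-resp-≈ : ∀ B {x y} → x ≈ y → x ∈B B → y ∈B B
∈B-resp-≈ (cyl [])      x≈y _            = tt
∈B-resp-≈ (cyl (m ∷ s)) x≈y (x₀≡m , x∈s) =
  trans (sym (x≈y 0)) x₀≡m , ∈B-resp-≈ (cyl s) (x≈y ∘ suc) x∈s
∈B-resp-≈ (compl B)     x≈y x∉B y∈B      = x∉B (∈B-resp-≈ B (≈-sym x≈y) y∈B)
∈B-resp-≈ (⋃ Bs)        x≈y (n , x∈Bₙ)   = n , ∈B-resp-≈ (Bs n) x≈y x∈Bₙ

∈B-cong : ∀ B {x y} → x ≈ y → x ∈B B ⇔ y ∈B B
∈B-cong B x≈y = mk⇔ (∈B-resp-≈ B x≈y) (∈B-resp-≈ B (≈-sym x≈y))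

pair-cong : ∀ {x x′ y y′} → x ≈ x′ → y ≈ y′ → pair x y ≈ pair x′ y′
pair-cong x≈x′ y≈y′ zero          = x≈x′ 0
pair-cong x≈x′ y≈y′ (suc zero)    = y≈y′ 0
pair-cong x≈x′ y≈y′ (suc (suc n)) = pair-cong (x≈x′ ∘ suc) (y≈y′ ∘ suc) n

preimage : (List ℕ → Borel) → Borel → Borel
preimage cyl⁻¹ (cyl s)   = cyl⁻¹ s
preimage cyl⁻¹ (compl B) = compl (preimage cyl⁻¹ B)
preimage cyl⁻¹ (⋃ Bs)    = ⋃ (preimage cyl⁻¹ ∘ Bs)

∈-preimage : ∀ {φ : Baire → Baire} cyl⁻¹ →
             (∀ s t → t ∈B cyl⁻¹ s ⇔ Extends (φ t) s) →
             ∀ B t → t ∈B preimage cyl⁻¹ B ⇔ φ t ∈B B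
∈-preimage cyl⁻¹ ∈-cyl⁻¹ (cyl s)   t = ∈-cyl⁻¹ s t
∈-preimage cyl⁻¹ ∈-cyl⁻¹ (compl B) t =
  mk⇔ (λ t∉ φt∈ → t∉ (from ih φt∈)) (λ φt∉ t∈ → φt∉ (to ih t∈))
  where ih = ∈-preimage cyl⁻¹ ∈-cyl⁻¹ B t
∈-preimage cyl⁻¹ ∈-cyl⁻¹ (⋃ Bs)    t =
  mk⇔ (λ (n , t∈) → n , to (ih n) t∈) (λ (n , φt∈) → n , from (ih n) φt∈)
  where ih = λ n → ∈-preimage cyl⁻¹ ∈-cyl⁻¹ (Bs n) t

-- Unlike Borel codes, open codes are closed under m ∷_ without intersections, whose
-- membership is only stable under double negation.

data Open : Set where
  basic : List ℕ → Open
  ⋃ₒ    : (ℕ → Open) → Open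

_∈ₒ_ : Baire → Open → Set
x ∈ₒ basic s = Extends x s
x ∈ₒ ⋃ₒ Us   = Σ ℕ λ n → x ∈ₒ Us n

toBorel : Open → Borel
toBorel (basic s) = cyl s
toBorel (⋃ₒ Us)   = ⋃ (toBorel ∘ Us)

∈-toBorel : ∀ U x → x ∈B toBorel U ⇔ x ∈ₒ U
∈-toBorel (basic s) x = ⇔-refl
∈-toBorel (⋃ₒ Us)   x =
  mk⇔ (λ (n , x∈) → n , to (∈-toBorel (Us n) x) x∈)
      (λ (n , x∈) → n , from (∈-toBorel (Us n) x) x∈)

_∷ₒ_ : ℕ → Open → Open
m ∷ₒ basic s = basic (m ∷ s)
m ∷ₒ ⋃ₒ Us   = ⋃ₒ λ n → m ∷ₒ Us n

∈-∷ₒ : ∀ m U x → x ∈ₒ (m ∷ₒ U) ⇔ (x 0 ≡ m × (x ∘ suc) ∈ₒ U)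
∈-∷ₒ m (basic s) x = ⇔-refl
∈-∷ₒ m (⋃ₒ Us)   x =
  mk⇔ (λ (n , x∈) → let (x₀≡m , x′∈) = to (∈-∷ₒ m (Us n) x) x∈ in x₀≡m , n , x′∈)
      (λ (x₀≡m , n , x′∈) → n , from (∈-∷ₒ m (Us n) x) (x₀≡m , x′∈))

tail⁻¹ : Open → Open
tail⁻¹ U = ⋃ₒ λ m → m ∷ₒ U

∈-tail⁻¹ : ∀ U x → x ∈ₒ tail⁻¹ U ⇔ (x ∘ suc) ∈ₒ U
∈-tail⁻¹ U x =
  mk⇔ (λ (m , x∈) → proj₂ (to (∈-∷ₒ m U x) x∈))
      (λ x′∈ → x 0 , from (∈-∷ₒ (x 0) U x) (refl , x′∈))

evens : Baire → Baire
evens t zero    = t 0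
evens t (suc n) = evens (t ∘ suc ∘ suc) n

odds : Baire → Baire
odds t = evens (t ∘ suc)

evens-pair : ∀ x y → evens (pair x y) ≈ x
evens-pair x y zero    = refl
evens-pair x y (suc n) = evens-pair (x ∘ suc) (y ∘ suc) n

odds-pair : ∀ x y → odds (pair x y) ≈ y
odds-pair x y zero    = refl
odds-pair x y (suc n) = odds-pair (x ∘ suc) (y ∘ suc) n

evens⁻¹-cyl : List ℕ → Open
evens⁻¹-cyl []      = basic []
evens⁻¹-cyl (m ∷ s) = m ∷ₒ tail⁻¹ (evens⁻¹-cyl s)

∈-evens⁻¹-cyl : ∀ s t → t ∈ₒ evens⁻¹-cyl s ⇔ Extends (evens t) s
∈-evens⁻¹-cyl []      t = ⇔-refl
∈-evens⁻¹-cyl (m ∷ s) t =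
  ⇔-trans (∈-∷ₒ m (tail⁻¹ (evens⁻¹-cyl s)) t)
    (mk⇔ (λ (t₀≡m , t′∈) → t₀≡m , to ih t′∈) (λ (t₀≡m , ext) → t₀≡m , from ih ext))
  where ih = ⇔-trans (∈-tail⁻¹ (evens⁻¹-cyl s) (t ∘ suc)) (∈-evens⁻¹-cyl s (t ∘ suc ∘ suc))

evens⁻¹ odds⁻¹ : Borel → Borel
evens⁻¹ = preimage (toBorel ∘ evens⁻¹-cyl)
odds⁻¹  = preimage (toBorel ∘ tail⁻¹ ∘ evens⁻¹-cyl)

∈-evens⁻¹ : ∀ B t → t ∈B evens⁻¹ B ⇔ evens t ∈B B
∈-evens⁻¹ = ∈-preimage (toBorel ∘ evens⁻¹-cyl) λ s t →
  ⇔-trans (∈-toBorel (evens⁻¹-cyl s) t) (∈-evens⁻¹-cyl s t)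

∈-odds⁻¹ : ∀ B t → t ∈B odds⁻¹ B ⇔ odds t ∈B B
∈-odds⁻¹ = ∈-preimage (toBorel ∘ tail⁻¹ ∘ evens⁻¹-cyl) λ s t →
  ⇔-trans (∈-toBorel (tail⁻¹ (evens⁻¹-cyl s)) t)
    (⇔-trans (∈-tail⁻¹ (evens⁻¹-cyl s) t) (∈-evens⁻¹-cyl s (t ∘ suc)))

first⁻¹ second⁻¹ third⁻¹ : Borel → Borel
first⁻¹  = evens⁻¹
second⁻¹ = odds⁻¹ ∘ evens⁻¹
third⁻¹  = odds⁻¹ ∘ odds⁻¹

∈-first⁻¹ : ∀ B x y z → triple x y z ∈B first⁻¹ B ⇔ x ∈B B
∈-first⁻¹ B x y z = ⇔-trans (∈-evens⁻¹ B _) (∈B-cong B (evens-pair x _))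

∈-second⁻¹ : ∀ B x y z → triple x y z ∈B second⁻¹ B ⇔ y ∈B B
∈-second⁻¹ B x y z =
  ⇔-trans (∈-odds⁻¹ (evens⁻¹ B) _)
    (⇔-trans (∈B-cong (evens⁻¹ B) (odds-pair x (pair y z)))
      (⇔-trans (∈-evens⁻¹ B _) (∈B-cong B (evens-pair y z))))

∈-third⁻¹ : ∀ B x y z → triple x y z ∈B third⁻¹ B ⇔ z ∈B B
∈-third⁻¹ B x y z =
  ⇔-trans (∈-odds⁻¹ (odds⁻¹ B) _)
    (⇔-trans (∈B-cong (odds⁻¹ B) (odds-pair x (pair y z)))
      (⇔-trans (∈-odds⁻¹ B _) (∈B-cong B (odds-pair y z))))

infixr 25 _∪_
infixr 26 _∩_

_∪_ _∩_ : Borel → Borel → Borel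
P ∪ Q = ⋃ λ { zero → P ; (suc _) → Q }
P ∩ Q = compl (compl P ∪ compl Q)

constant : Bool → Borel
constant true  = cyl []
constant false = compl (cyl [])

split-on : Borel → (Bool → Borel) → Borel
split-on X F = X ∩ F true ∪ compl X ∩ F false

combination : ∀ {n} → (Vec Bool n → Bool) → Vec Borel n → Borel
combination φ []       = constant (φ [])
combination φ (X ∷ Xs) = split-on X λ u → combination (φ ∘ (u ∷_)) Xs

reflects-⇔ : ∀ {A B : Set} {b} → A ⇔ B → Reflects A b → Reflects B b
reflects-⇔ A⇔B (ofʸ p)  = ofʸ (to A⇔B p)
reflects-⇔ A⇔B (ofⁿ ¬p) = ofⁿ (¬p ∘ from A⇔B)

≡true⇔-reflects : ∀ {A : Set} {b} → (b ≡ true ⇔ A) → Reflects A b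
≡true⇔-reflects {b = true}  b⇔A = ofʸ (to b⇔A refl)
≡true⇔-reflects {b = false} b⇔A = ofⁿ ((λ ()) ∘ from b⇔A)

reflects-≡true⇔ : ∀ {A : Set} {b} → Reflects A b → (b ≡ true ⇔ A)
reflects-≡true⇔ (ofʸ p)  = mk⇔ (λ _ → p) (λ _ → refl)
reflects-≡true⇔ (ofⁿ ¬p) = mk⇔ (λ ()) (⊥-elim ∘ ¬p)

module _ {x : Baire} where

  constant-reflects : ∀ b → Reflects (x ∈B constant b) b
  constant-reflects true  = ofʸ tt
  constant-reflects false = ofⁿ λ x∉ → x∉ tt

  ∪-reflects : ∀ {P Q u v} → Reflects (x ∈B P) u → Reflects (x ∈B Q) v →
               Reflects (x ∈B P ∪ Q) (u ∨ v)
  ∪-reflects rP rQ = reflects-⇔ (mk⇔ join split) (rP ⊎-reflects rQ)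
    where
      join = λ { (inj₁ x∈P) → 0 , x∈P ; (inj₂ x∈Q) → 1 , x∈Q }
      split = λ { (zero , x∈P) → inj₁ x∈P ; (suc _ , x∈Q) → inj₂ x∈Q }

  ∩-reflects : ∀ {P Q u v} → Reflects (x ∈B P) u → Reflects (x ∈B Q) v →
               Reflects (x ∈B P ∩ Q) (u ∧ v)
  ∩-reflects {u = u} {v} rP rQ =
    subst (Reflects _) (de-Morgan u v) (¬-reflects (∪-reflects (¬-reflects rP) (¬-reflects rQ)))
    where
      de-Morgan : ∀ u v → not (not u ∨ not v) ≡ u ∧ v
      de-Morgan true  v = Bool.not-involutive v
      de-Morgan false v = refl

  split-on-reflects : ∀ X F {G : Bool → Bool} {u} → Reflects (x ∈B X) u →
                      (∀ v → Reflects (x ∈B F v) (G v)) → Reflects (x ∈B split-on X F) (G u)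
  split-on-reflects X F {G} {u} rX rF = subst (Reflects _) (shannon u) expansion
    where
      expansion : Reflects (x ∈B split-on X F) ((u ∧ G true) ∨ (not u ∧ G false))
      expansion = ∪-reflects {u = u ∧ G true} (∩-reflects rX (rF true))
                                             (∩-reflects (¬-reflects rX) (rF false))
      shannon : ∀ u → (u ∧ G true) ∨ (not u ∧ G false) ≡ G u
      shannon true  = Bool.∨-identityʳ (G true)
      shannon false = refl

  combination-reflects : ∀ {n} (φ : Vec Bool n → Bool) {Xs us} →
                         Pointwise (λ X u → Reflects (x ∈B X) u) Xs us →
                         Reflects (x ∈B combination φ Xs) (φ us)
  combination-reflects φ []                  = constant-reflects (φ [])
  combination-reflects φ {X ∷ Xs} (rX ∷ rXs) =
    split-on-reflects X (λ u → combination (φ ∘ (u ∷_)) Xs) rX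
      λ u → combination-reflects (φ ∘ (u ∷_)) rXs

labelled : Label → Tmpl
labelled a'ℓ = a'
labelled b'ℓ = b'
labelled c'ℓ = c'

gadgetColour : Bool → Bool → Bool → Tmpl → Bool
gadgetColour A B C a  = A
gadgetColour A B C b  = B
gadgetColour A B C c  = C
gadgetColour A B C a' = if A xor B then not B else not C
gadgetColour A B C b' = if A xor B then not A else not C
gadgetColour A B C c' = if A xor B then not A else C

gadgetColour-cong : ∀ t {A A′ B B′ C C′} → A ≡ A′ → B ≡ B′ → C ≡ C′ →
                    gadgetColour A B C t ≡ gadgetColour A′ B′ C′ t
gadgetColour-cong t refl refl refl = refl

-- The first component indexes v₁, v₂, v₃.
LocalKey : Set
LocalKey = Fin 3 × ℕ

_<ₗ_ : LocalKey → LocalKey → Set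
_<ₗ_ = ×-Lex _≡_ Fin._<_ ℕ._<_

gadgetKey : Bool → Bool → Tmpl → LocalKey
gadgetKey A B a  = # 0 , 2
gadgetKey A B b  = # 1 , 2
gadgetKey A B c  = # 2 , 2
gadgetKey A B a' = if A xor B then (# 2 , 3) else (# 0 , 0)
gadgetKey A B b' = if A xor B then (# 2 , 3) else (# 0 , 1)
gadgetKey A B c' = if A xor B then (# 2 , 4) else (# 0 , 4)

NonConstant : Bool → Bool → Bool → Set
NonConstant A B C = ¬ (A ≡ B × B ≡ C)

MonochromeArcIncreases : Tmpl → Tmpl → Bool → Bool → Bool → Set
MonochromeArcIncreases s t A B C =
  NonConstant A B C → gadgetColour A B C s ≡ gadgetColour A B C t →
  gadgetKey A B s <ₗ gadgetKey A B t

monochromeArcIncreases? : ∀ s t A B C → Dec (MonochromeArcIncreases s t A B C)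
monochromeArcIncreases? s t A B C =
  ¬? (A Bool.≟ B ×-dec B Bool.≟ C) →-dec
  gadgetColour A B C s Bool.≟ gadgetColour A B C t →-dec
  ×-decidable Fin._≟_ Fin._<?_ ℕ._<?_ (gadgetKey A B s) (gadgetKey A B t)

∀-Bool? : ∀ {P : Bool → Set} → (∀ u → Dec (P u)) → Dec (∀ u → P u)
∀-Bool? P? = map′ (λ (p₀ , p₁) → λ { false → p₀ ; true → p₁ }) (λ p → p false , p true)
                  (P? false ×-dec P? true)

gadget-arc-increases : ∀ {s t} → TArc s t → ∀ A B C → MonochromeArcIncreases s t A B C
gadget-arc-increases {s} {t} arc = toWitness (checked arc)
  where
    allColourings? = ∀-Bool? λ A → ∀-Bool? λ B → ∀-Bool? λ C → monochromeArcIncreases? s t A B C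
    checked : TArc s t → True allColourings?
    checked a→b   = tt
    checked b→c   = tt
    checked a→c   = tt
    checked a'→b' = tt
    checked b'→c' = tt
    checked c'→a' = tt
    checked c'→a  = tt
    checked c→a'  = tt
    checked b'→a  = tt
    checked b→c'  = tt
    checked a'→b  = tt
    checked c→b'  = tt

module _ {V K : Set} (_<_ : K → K → Set) (<-trans : Transitive _<_)
         (R : V → V → Set) (key : V → K) (increasing : ∀ {u w} → R u w → key u < key w) where

  walk-increases : ∀ k (w : Fin (suc k) → V) → (∀ i → R (w (inject₁ i)) (w (Fin.suc i))) →
                   ∀ {v} → R (w (fromℕ k)) v → key (w Fin.zero) < key v
  walk-increases zero    w steps last = increasing last
  walk-increases (suc k) w steps last =
    <-trans (walk-increases k (w ∘ inject₁) (steps ∘ inject₁) (steps (fromℕ k))) (increasing last)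

  no-closed-walk : (∀ {k} → ¬ k < k) → ∀ k (w : Fin (suc k) → V) →
                   (∀ i → R (w (inject₁ i)) (w (Fin.suc i))) → ¬ R (w (fromℕ k)) (w Fin.zero)
  no-closed-walk <-irrefl k w steps last = <-irrefl (walk-increases k w steps last)

module KeyOrder (O : BorelLinearOrder) where
  open BorelLinearOrder O

  infix 4 _≺_ _<ₖ_ _≈ₖ_

  _≺_ : Baire → Baire → Set
  x ≺ y = x ⪯ y × ¬ y ⪯ x

  ⪯-resp-≈ : ∀ {x x′ y y′} → x ≈ x′ → y ≈ y′ → x ⪯ y → x′ ⪯ y′
  ⪯-resp-≈ x≈x′ y≈y′ = ∈B-resp-≈ L (pair-cong x≈x′ y≈y′)

  ⪯-≉⇒≺ : ∀ {x y} → x ⪯ y → ¬ x ≈ y → x ≺ y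
  ⪯-≉⇒≺ x⪯y x≉y = x⪯y , λ y⪯x → x≉y (antisym⪯ x⪯y y⪯x)

  ≺-trans : Transitive _≺_
  ≺-trans (x⪯y , y⋠x) (y⪯z , z⋠y) = trans⪯ x⪯y y⪯z , λ z⪯x → z⋠y (trans⪯ z⪯x x⪯y)

  ≺-irrefl : Irreflexive _≈_ _≺_
  ≺-irrefl x≈y (x⪯y , y⋠x) = y⋠x (⪯-resp-≈ x≈y (≈-sym x≈y) x⪯y)

  ≺-resp-≈ : _≺_ Respects₂ _≈_
  ≺-resp-≈ = (λ y≈y′ (x⪯y , y⋠x) → ⪯-resp-≈ ≈-refl y≈y′ x⪯y , y⋠x ∘ ⪯-resp-≈ (≈-sym y≈y′) ≈-refl)
           , (λ x≈x′ (x⪯y , y⋠x) → ⪯-resp-≈ x≈x′ ≈-refl x⪯y , y⋠x ∘ ⪯-resp-≈ ≈-refl (≈-sym x≈x′))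

  Key : Set
  Key = Baire × ℕ

  _<ₖ_ _≈ₖ_ : Key → Key → Set
  _<ₖ_ = ×-Lex _≈_ _≺_ ℕ._<_
  _≈ₖ_ = Pointwise₂ _≈_ _≡_

  ≈ₖ-sym : ∀ {k l} → k ≈ₖ l → l ≈ₖ k
  ≈ₖ-sym (x≈y , m≡n) = ≈-sym x≈y , sym m≡n

  <ₖ-trans : Transitive _<ₖ_
  <ₖ-trans = ×-transitive {_≈₁_ = _≈_} {_<₁_ = _≺_} {_<₂_ = ℕ._<_}
               ≈-isEquivalence ≺-resp-≈ ≺-trans ℕ.<-trans

  <ₖ-irrefl : ∀ {k} → ¬ k <ₖ k
  <ₖ-irrefl = ×-irreflexive {_≈₁_ = _≈_} {_<₁_ = _≺_} {_<₂_ = ℕ._<_}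
                ≺-irrefl ℕ.<-irrefl (≈-refl , refl)

  <ₖ-resp-≈ₖ : _<ₖ_ Respects₂ _≈ₖ_
  <ₖ-resp-≈ₖ = ×-respects₂ {_≈₁_ = _≈_} {_<₁_ = _≺_} {_<₂_ = ℕ._<_}
                 ≈-isEquivalence ≺-resp-≈ (resp₂ ℕ._<_)

  Sorted₃ : (Fin 3 → Baire) → Set
  Sorted₃ v = v (# 0) ≺ v (# 1) × v (# 1) ≺ v (# 2)

  embed : (Fin 3 → Baire) → LocalKey → Key
  embed v (i , n) = v i , n

  embed-cong : ∀ {v w k l} → (∀ i → v i ≈ w i) → k ≡ l → embed v k ≈ₖ embed w l
  embed-cong v≈w refl = v≈w _ , refl

  embed-mono : ∀ v → Sorted₃ v → ∀ {k l} → k <ₗ l → embed v k <ₖ embed v l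
  embed-mono v (v₀≺v₁ , v₁≺v₂) (inj₁ i<j)          = inj₁ (sorted i<j)
    where
      sorted : ∀ {i j} → i Fin.< j → v i ≺ v j
      sorted {Fin.zero}            {Fin.suc Fin.zero}           _ = v₀≺v₁
      sorted {Fin.zero}            {Fin.suc (Fin.suc Fin.zero)} _ = ≺-trans v₀≺v₁ v₁≺v₂
      sorted {Fin.suc Fin.zero}    {Fin.suc (Fin.suc Fin.zero)} _ = v₁≺v₂
      sorted {Fin.suc _}           {Fin.suc Fin.zero}           (ℕ.s≤s ())
      sorted {Fin.suc (Fin.suc _)} {Fin.suc (Fin.suc Fin.zero)} (ℕ.s≤s (ℕ.s≤s ()))
  embed-mono v _               (inj₂ (refl , m<n)) = inj₂ (≈-refl , m<n)

module Dicolouring (H : Borel3Hypergraph) (O : BorelLinearOrder) (f : VPt H → Bool)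
  (Bf : Borel) (f-Borel : ∀ x p → f (x , p) ≡ true ⇔ x ∈B Bf)
  (f-proper : ∀ x y z px py pz → triple x y z ∈B Borel3Hypergraph.E H →
              NonConstant (f (x , px)) (f (y , py)) (f (z , pz))) where

  open Borel3Hypergraph H
  open KeyOrder O
  open DGraph H O
  open ≡-Reasoning

  f-reflects : ∀ x p → Reflects (x ∈B Bf) (f (x , p))
  f-reflects x p = ≡true⇔-reflects (f-Borel x p)

  f-resp-≈ : ∀ {x y} p q → x ≈ y → f (x , p) ≡ f (y , q)
  f-resp-≈ {x} {y} p q x≈y =
    det (f-reflects x p) (reflects-⇔ (∈B-cong Bf (≈-sym x≈y)) (f-reflects y q))

  corner : ESortPt → Fin 3 → Baire
  corner ((x , _ , _) , _) Fin.zero              = x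
  corner ((_ , y , _) , _) (Fin.suc Fin.zero)    = y
  corner ((_ , _ , z) , _) (Fin.suc (Fin.suc _)) = z

  corners-sorted : ∀ e → Sorted₃ (corner e)
  corners-sorted (_ , e∈E , x⪯y , y⪯z) =
    ⪯-≉⇒≺ x⪯y (proj₁ (distinct e∈E)) , ⪯-≉⇒≺ y⪯z (proj₁ (proj₂ (distinct e∈E)))

  colour₁ colour₂ colour₃ : ESortPt → Bool
  colour₁ ((x , _ , _) , e∈E , _) = f (x , proj₁ (E⊆V³ e∈E))
  colour₂ ((_ , y , _) , e∈E , _) = f (y , proj₁ (proj₂ (E⊆V³ e∈E)))
  colour₃ ((_ , _ , z) , e∈E , _) = f (z , proj₂ (proj₂ (E⊆V³ e∈E)))

  hyperedgeColour : ESortPt → Tmpl → Bool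
  hyperedgeColour e = gadgetColour (colour₁ e) (colour₂ e) (colour₃ e)

  hyperedgeKey : ESortPt → Tmpl → Key
  hyperedgeKey e = embed (corner e) ∘ gadgetKey (colour₁ e) (colour₂ e)

  colour : DV → Bool
  colour (inj₁ v)       = f v
  colour (inj₂ (e , ℓ)) = hyperedgeColour e (labelled ℓ)

  key : DV → Key
  key (inj₁ (x , _)) = x , 2
  key (inj₂ (e , ℓ)) = hyperedgeKey e (labelled ℓ)

  colour-img : ∀ e t → colour (img e t) ≡ hyperedgeColour e t
  colour-img e a  = refl
  colour-img e b  = refl
  colour-img e c  = refl
  colour-img e a' = refl
  colour-img e b' = refl
  colour-img e c' = refl

  key-img : ∀ e t → key (img e t) ≡ hyperedgeKey e t
  key-img e a  = refl
  key-img e b  = refl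
  key-img e c  = refl
  key-img e a' = refl
  key-img e b' = refl
  key-img e c' = refl

  colour-resp-≋ : ∀ {u w} → u ≋ w → colour u ≡ colour w
  colour-resp-≋ {inj₁ (_ , p)} {inj₁ (_ , q)} x≈y = f-resp-≈ p q x≈y
  colour-resp-≋ {inj₂ (_ , ℓ)} {inj₂ (_ , ℓ)} (x≈ , y≈ , z≈ , refl) =
    gadgetColour-cong (labelled ℓ) (f-resp-≈ _ _ x≈) (f-resp-≈ _ _ y≈) (f-resp-≈ _ _ z≈)

  key-resp-≋ : ∀ {u w} → u ≋ w → key u ≈ₖ key w
  key-resp-≋ {inj₁ _}       {inj₁ _}        x≈y = x≈y , refl
  key-resp-≋ {inj₂ (e , ℓ)} {inj₂ (e′ , ℓ)} (x≈ , y≈ , z≈ , refl) =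
    embed-cong corner≈
      (cong₂ (λ A B → gadgetKey A B (labelled ℓ)) (f-resp-≈ _ _ x≈) (f-resp-≈ _ _ y≈))
    where
      corner≈ : ∀ i → corner e i ≈ corner e′ i
      corner≈ Fin.zero              = x≈
      corner≈ (Fin.suc Fin.zero)    = y≈
      corner≈ (Fin.suc (Fin.suc _)) = z≈

  hyperedgeKey-≈ₖ : ∀ {v} e t → v ≋ img e t → hyperedgeKey e t ≈ₖ key v
  hyperedgeKey-≈ₖ e t v≋ = subst (_≈ₖ _) (key-img e t) (≈ₖ-sym (key-resp-≋ v≋))

  monochrome-arc-increases : ∀ {u w} → Arc u w × colour u ≡ colour w → key u <ₖ key w
  monochrome-arc-increases {u} {w} ((e@((x , y , z) , e∈E , _) , s , t , arc , u≋ , w≋) , same) =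
    proj₂ <ₖ-resp-≈ₖ (hyperedgeKey-≈ₖ e s u≋) (proj₁ <ₖ-resp-≈ₖ (hyperedgeKey-≈ₖ e t w≋) lifted)
    where
      sameColour : hyperedgeColour e s ≡ hyperedgeColour e t
      sameColour = begin
        hyperedgeColour e s ≡⟨ sym (trans (colour-resp-≋ u≋) (colour-img e s)) ⟩
        colour u            ≡⟨ same ⟩
        colour w            ≡⟨ trans (colour-resp-≋ w≋) (colour-img e t) ⟩
        hyperedgeColour e t ∎
      lifted : hyperedgeKey e s <ₖ hyperedgeKey e t
      lifted = embed-mono (corner e) (corners-sorted e)
                 (gadget-arc-increases arc (colour₁ e) (colour₂ e) (colour₃ e)
                   (f-proper x y z _ _ _ e∈E) sameColour)

  colour-Borel : IsBorelMapD colour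
  colour-Borel = (Bf , f-Borel) , λ ℓ → gadgetCode ℓ , λ e → reflects-≡true⇔ (gadget-reflects ℓ e)
    where
      gadgetColourᵛ : Tmpl → Vec Bool 3 → Bool
      gadgetColourᵛ t (A ∷ B ∷ C ∷ []) = gadgetColour A B C t
      gadgetCode : Label → Borel
      gadgetCode ℓ = combination (gadgetColourᵛ (labelled ℓ))
                       (first⁻¹ Bf ∷ second⁻¹ Bf ∷ third⁻¹ Bf ∷ [])
      gadget-reflects : ∀ ℓ e → let ((x , y , z) , _) = e in
                        Reflects (triple x y z ∈B gadgetCode ℓ) (colour (inj₂ (e , ℓ)))
      gadget-reflects ℓ ((x , y , z) , _) =
        combination-reflects (gadgetColourᵛ (labelled ℓ))
          ( reflects-⇔ (⇔-sym (∈-first⁻¹ Bf x y z)) (f-reflects x _)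
          ∷ reflects-⇔ (⇔-sym (∈-second⁻¹ Bf x y z)) (f-reflects y _)
          ∷ reflects-⇔ (⇔-sym (∈-third⁻¹ Bf x y z)) (f-reflects z _)
          ∷ [])

  dicolouring : Borel2Dicoloring
  dicolouring = colour , colour-Borel , λ k w (steps , last) monochrome →
    no-closed-walk _<ₖ_ <ₖ-trans (λ u v → Arc u v × colour u ≡ colour v)
      key monochrome-arc-increases <ₖ-irrefl k w
      (λ i → steps i , trans (monochrome _) (sym (monochrome _)))
      (last , trans (monochrome _) (sym (monochrome _)))

claim4p3 : (H : Borel3Hypergraph) → LocallyFinite H → (O : BorelLinearOrder) →
    Borel2Coloring H → DGraph.Borel2Dicoloring H O
claim4p3 H _ O (f , (Bf , f-Borel) , f-proper) = Dicolouring.dicolouring H O f Bf f-Borel f-proper
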